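{- The set of supports of the weight-$6$ codewords of the binary extended Hamming code of length $16$ is a completely regular code in the Johnson graph $J(16,6)$ with covering radius $2$.
   Context: The Johnson graph $J(n,k)$ has as vertices the $k$-subsets of $\{1,\dots,n\}$, two being adjacent when they meet in a $(k-1)$-subset. For a code $C$ in a connected graph, $C_i$ is the set of vertices at distance exactly $i$ from $C$, the covering radius $\rho$ is the maximal such distance, and $C$ is completely regular if there are numbers $\alpha_i,\beta_i,\gamma_i$ such that each vertex of $C_i$ has exactly $\gamma_i$ neighbours in $C_{i-1}$, $\alpha_i$ in $C_i$ and $\beta_i$ in $C_{i+1}$. -}

module Defs where

open import Data.Bool using (Bool; true; false; _∧_; _∨_; not; _xor_; if_then_else_)
open import Data.Nat using (ℕ; zero; suc; _^_; _≡ᵇ_; ⌊_/2⌋; _%_)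
open import Data.Fin using (Fin; toℕ)
open import Data.Fin.Subset using (Subset; _∩_; ∣_∣)
open import Data.Vec using (Vec; []; _∷_; tabulate; zipWith; foldr; toList)
open import Data.List using (List; []; _∷_; _++_; map; filterᵇ; length)
open import Data.Bool.ListAction using (any)
open import Data.List.Membership.Propositional using (_∈_)
open import Data.Product using (_×_; ∃; _,_)
open import Relation.Binary.PropositionalEquality using (_≡_)

record FinGraph (V : Set) : Set where
  field
    vertices : List V
    adj      : V → V → Bool

module _ {V : Set} (G : FinGraph V) (C : V → Bool) where
  open FinGraph G

  within : ℕ → V → Bool
  within zero    x = C x
  within (suc i) x = within i x ∨ any (λ y → adj x y ∧ within i y) vertices

  layer : ℕ → V → Bool
  layer zero    x = C x
  layer (suc i) x = within (suc i) x ∧ not (within i x)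

  nbrsIn : ℕ → V → ℕ
  nbrsIn j x = length (filterᵇ (λ y → adj x y ∧ layer j y) vertices)

  CoveringRadius : ℕ → Set
  CoveringRadius ρ =
    (∀ x → x ∈ vertices → within ρ x ≡ true) × (∃ λ x → x ∈ vertices × layer ρ x ≡ true)

  -- Completely regular: there are numbers α_i, β_i, γ_i such that every
  -- vertex of C_i has exactly γ_i neighbours in C_{i-1} (for i ≥ 1; C_{-1}
  -- is empty, so γ_0 = 0 is automatic), α_i in C_i and β_i in C_{i+1}.
  CompletelyRegular : Set
  CompletelyRegular =
    ∃ λ (α : ℕ → ℕ) → ∃ λ (β : ℕ → ℕ) → ∃ λ (γ : ℕ → ℕ) →
      ∀ i x → x ∈ vertices → layer i x ≡ true →
        nbrsIn i x ≡ α i × nbrsIn (suc i) x ≡ β i ×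
        (∀ j → i ≡ suc j → nbrsIn j x ≡ γ i)

allSubsets : (n : ℕ) → List (Subset n)
allSubsets zero    = [] ∷ []
allSubsets (suc n) = map (false ∷_) (allSubsets n) ++ map (true ∷_) (allSubsets n)

pred : ℕ → ℕ
pred zero    = zero
pred (suc k) = k

Johnson : (n k : ℕ) → FinGraph (Subset n)
Johnson n k = record
  { vertices = filterᵇ (λ A → ∣ A ∣ ≡ᵇ k) (allSubsets n)
  ; adj      = λ A B → (∣ A ∣ ≡ᵇ k) ∧ (∣ B ∣ ≡ᵇ k) ∧ (∣ A ∩ B ∣ ≡ᵇ pred k)
  }

-- Binary extended Hamming code of length 2^m: coordinates indexed by
-- Fin (2^m), coordinate i identified with the binary expansion of toℕ i
-- (a vector of F_2^m).  Parity-check matrix: the all-ones row together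
-- with the m rows giving the bits of the coordinate labels.

bit : ℕ → ℕ → Bool
bit zero    m = m % 2 ≡ᵇ 1
bit (suc j) m = bit j ⌊ m /2⌋

dotF₂ : ∀ {n} → Vec Bool n → Vec Bool n → Bool
dotF₂ r c = foldr _ _xor_ false (zipWith _∧_ r c)

checkRows : (m : ℕ) → List (Vec Bool (2 ^ m))
checkRows m = tabulate (λ _ → true) ∷ map (λ j → tabulate (λ i → bit j (toℕ i))) (toList (tabulate {n = m} toℕ))

isExtHammingCodeword : (m : ℕ) → Vec Bool (2 ^ m) → Bool
isExtHammingCodeword m c = not (any (λ r → dotF₂ r c) (checkRows m))

hammingWeight6Supports : Subset 16 → Bool
hammingWeight6Supports A = (∣ A ∣ ≡ᵇ 6) ∧ isExtHammingCodeword 4 A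

-- A function d on the vertices of a finite graph that vanishes exactly on C, decreases by one
-- along some edge at every vertex outside C and increases by at most one along every edge is
-- the distance to C: by induction on i, d x ≤ i iff x lies within distance i of C.  Here d is
-- 0 on the code, 1 on the vertices with a neighbour in the code and 2 elsewhere.  Evaluation
-- checks at each of the 8008 vertices of J(16,6) that d satisfies these local conditions and
-- that a vertex with d = i has γᵢ, αᵢ, βᵢ neighbours with d = i - 1, i, i + 1, the intersection
-- array being {60, 6; 4, 48}.  The neighbours of a 6-set are enumerated as its 6 · 10
-- exchanges of one point instead of by filtering all vertices.
module Submission where

open import Defs
open import Data.Bool using (Bool; true; false; T; _∧_; _∨_; not; if_then_else_)
open import Data.Bool.Properties using (T-∨; T-≡; ∧-assoc; ∧-idem; ∧-zeroʳ; ∧-identityʳ)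
  renaming (_≟_ to _≟ᵇ_)
open import Data.Bool.ListAction using (all; any)
open import Data.Empty using (⊥-elim)
open import Data.Fin.Subset using (Subset; _∩_; ∁; ∣_∣)
open import Data.Fin.Subset.Properties using (∩-comm)
open import Data.List using (List; []; _∷_; [_]; _++_; map; filterᵇ; length)
open import Data.List.Properties using (filter-++; length-map; ++-identityʳ)
open import Data.List.Membership.Propositional using (_∈_; find; lose)
open import Data.List.Membership.Propositional.Properties
  using (∈-filter⁺; ∈-filter⁻; ∈-map⁺; ∈-map⁻; ∈-++⁺ˡ; ∈-++⁺ʳ)
open import Data.List.Relation.Unary.All as All using (All; all?)
open import Data.List.Relation.Unary.All.Properties using (all⁺; map⁻)
open import Data.List.Relation.Unary.Any using (here; there)
open import Data.List.Relation.Unary.Any.Properties using (any⁺; any⁻)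
open import Data.Nat using (ℕ; zero; suc; _+_; _≤_; _<_; z≤n; s≤s; _≡ᵇ_; _≤ᵇ_)
open import Data.Nat.Properties
  using (_≟_; _≤?_; ≡ᵇ⇒≡; ≡⇒≡ᵇ; ≤ᵇ⇒≤; ≤⇒≤ᵇ; ≤-refl; ≤-trans; ≤-reflexive; ≤-pred;
         m≤n⇒m≤1+n; m≤n⇒m<n∨m≡n; m+n≡0⇒n≡0; +-suc; suc-injective)
open import Data.List.Membership.DecPropositional _≟_ using (_∈?_)
open import Data.Product using (_×_; _,_; proj₁; proj₂; ∃-syntax)
open import Data.Sum using (inj₁; inj₂)
open import Data.Unit using (⊤; tt)
open import Data.Vec using ([]; _∷_)
open import Function using (_∘_; Equivalence)
open import Relation.Binary.PropositionalEquality
  using (_≡_; refl; sym; trans; cong; cong₂; subst; module ≡-Reasoning)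
open import Relation.Nullary.Decidable using (Dec; yes; T?; ⌊_⌋; toWitness; map′; _×-dec_)

open ≡-Reasoning

T-ext : ∀ {a b} → (T a → T b) → (T b → T a) → a ≡ b
T-ext {false} {false} _ _ = refl
T-ext {false} {true}  _ g = ⊥-elim (g tt)
T-ext {true}  {false} f _ = ⊥-elim (f tt)
T-ext {true}  {true}  _ _ = refl

T⇒≡true : ∀ {a} → T a → a ≡ true
T⇒≡true = Equivalence.to T-≡

≡true⇒T : ∀ {a} → a ≡ true → T a
≡true⇒T = Equivalence.from T-≡

≡ᵇ0≡≤ᵇ0 : ∀ m → (m ≡ᵇ 0) ≡ (m ≤ᵇ 0)
≡ᵇ0≡≤ᵇ0 zero    = refl
≡ᵇ0≡≤ᵇ0 (suc m) = refl

≤ᵇ1+n∧≰ᵇn≡≡ᵇ1+n : ∀ m n → ((m ≤ᵇ suc n) ∧ not (m ≤ᵇ n)) ≡ (m ≡ᵇ suc n)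
≤ᵇ1+n∧≰ᵇn≡≡ᵇ1+n zero          n       = refl
≤ᵇ1+n∧≰ᵇn≡≡ᵇ1+n (suc zero)    zero    = refl
≤ᵇ1+n∧≰ᵇn≡≡ᵇ1+n (suc (suc m)) zero    = refl
≤ᵇ1+n∧≰ᵇn≡≡ᵇ1+n (suc zero)    (suc n) = refl
≤ᵇ1+n∧≰ᵇn≡≡ᵇ1+n (suc (suc m)) (suc n) = ≤ᵇ1+n∧≰ᵇn≡≡ᵇ1+n (suc m) n

module _ {A : Set} where

  filterᵇ-∧ : (p q : A → Bool) (xs : List A) →
              filterᵇ (λ y → p y ∧ q y) xs ≡ filterᵇ q (filterᵇ p xs)
  filterᵇ-∧ p q []       = refl
  filterᵇ-∧ p q (x ∷ xs) with p x
  ... | false = filterᵇ-∧ p q xs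
  ... | true with q x
  ...   | true  = cong (x ∷_) (filterᵇ-∧ p q xs)
  ...   | false = filterᵇ-∧ p q xs

  any-∧ : (p q : A → Bool) (xs : List A) → any (λ y → p y ∧ q y) xs ≡ any q (filterᵇ p xs)
  any-∧ p q []       = refl
  any-∧ p q (x ∷ xs) with p x
  ... | false = any-∧ p q xs
  ... | true  = cong (q x ∨_) (any-∧ p q xs)

  filterᵇ-none : {p : A → Bool} → (∀ y → p y ≡ false) → (xs : List A) → filterᵇ p xs ≡ []
  filterᵇ-none         none []       = refl
  filterᵇ-none {p = p} none (x ∷ xs) with p x | none x
  ... | false | refl = filterᵇ-none none xs

  filterᵇ-cong : {p q : A → Bool} (xs : List A) → (∀ {y} → y ∈ xs → p y ≡ q y) →
                 filterᵇ p xs ≡ filterᵇ q xs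
  filterᵇ-cong                 []       _   = refl
  filterᵇ-cong {p = p} {q = q} (x ∷ xs) p≡q with p x | q x | p≡q (here refl)
  ... | true  | true  | refl = cong (x ∷_) (filterᵇ-cong xs (p≡q ∘ there))
  ... | false | false | refl = filterᵇ-cong xs (p≡q ∘ there)

  -- xs is explicit and the hypothesis is an equation rather than T (all p xs): otherwise
  -- elaboration would normalise all p xs whenever p and xs are closed.
  all-∈ : (p : A → Bool) (xs : List A) {x : A} → all p xs ≡ true → x ∈ xs → p x ≡ true
  all-∈ p xs all≡true x∈ = T⇒≡true (All.lookup (all⁺ p xs (≡true⇒T all≡true)) x∈)

  any-cong : {p q : A → Bool} (xs : List A) → (∀ {y} → y ∈ xs → p y ≡ q y) →
             any p xs ≡ any q xs
  any-cong []       _   = refl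
  any-cong (x ∷ xs) p≡q = cong₂ _∨_ (p≡q (here refl)) (any-cong xs (p≡q ∘ there))

module _ {A B : Set} where

  filterᵇ-map : (p : B → Bool) (f : A → B) (xs : List A) →
                filterᵇ p (map f xs) ≡ map f (filterᵇ (p ∘ f) xs)
  filterᵇ-map p f []       = refl
  filterᵇ-map p f (x ∷ xs) with p (f x)
  ... | true  = cong (f x ∷_) (filterᵇ-map p f xs)
  ... | false = filterᵇ-map p f xs

  length-filterᵇ-map : (p : B → Bool) (f : A → B) (xs : List A) →
                       length (filterᵇ p (map f xs)) ≡ length (filterᵇ (p ∘ f) xs)
  length-filterᵇ-map p f xs =
    trans (cong length (filterᵇ-map p f xs)) (length-map f (filterᵇ (p ∘ f) xs))

count : ℕ → List ℕ → ℕ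
count j ds = length (filterᵇ (_≡ᵇ j) ds)

module _ {V : Set} (G : FinGraph V) (C : V → Bool) where
  open FinGraph G

  module DistanceCertificate
    (neighbours     : V → List V)
    (neighbours-≡   : ∀ {x} → x ∈ vertices → filterᵇ (adj x) vertices ≡ neighbours x)
    (dist           : V → ℕ)
    (dist-code      : ∀ {x} → x ∈ vertices → C x ≡ (dist x ≡ᵇ 0))
    (dist-descends  : ∀ {x} i → x ∈ vertices → dist x ≡ suc i →
                      ∃[ y ] (y ∈ neighbours x × dist y ≡ i))
    (dist-lipschitz : ∀ {x y} → x ∈ vertices → y ∈ neighbours x → dist x ≤ suc (dist y))
    where

    neighbours⊆vertices : ∀ {x y} → x ∈ vertices → y ∈ neighbours x → y ∈ vertices
    neighbours⊆vertices x∈ y∈ =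
      proj₁ (∈-filter⁻ (T? ∘ adj _) (subst (_ ∈_) (sym (neighbours-≡ x∈)) y∈))

    dist-≤ᵇ-suc : ∀ i {x} → x ∈ vertices →
                  ((dist x ≤ᵇ i) ∨ any (λ y → dist y ≤ᵇ i) (neighbours x)) ≡ (dist x ≤ᵇ suc i)
    dist-≤ᵇ-suc i {x} x∈ = T-ext reach descend
      where
      reach : T ((dist x ≤ᵇ i) ∨ any (λ y → dist y ≤ᵇ i) (neighbours x)) → T (dist x ≤ᵇ suc i)
      reach h with Equivalence.to (T-∨ {dist x ≤ᵇ i}) h
      ... | inj₁ x≤i = ≤⇒≤ᵇ (m≤n⇒m≤1+n (≤ᵇ⇒≤ (dist x) i x≤i))
      ... | inj₂ near with find (any⁻ _ _ near)
      ...   | y , y∈ , y≤i = ≤⇒≤ᵇ (≤-trans (dist-lipschitz x∈ y∈) (s≤s (≤ᵇ⇒≤ _ _ y≤i)))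
      descend : T (dist x ≤ᵇ suc i) → T ((dist x ≤ᵇ i) ∨ any (λ y → dist y ≤ᵇ i) (neighbours x))
      descend h with m≤n⇒m<n∨m≡n (≤ᵇ⇒≤ _ _ h)
      ... | inj₁ x<1+i = Equivalence.from T-∨ (inj₁ (≤⇒≤ᵇ (≤-pred x<1+i)))
      ... | inj₂ x≡1+i with dist-descends i x∈ x≡1+i
      ...   | y , y∈ , y≡i =
        Equivalence.from T-∨ (inj₂ (any⁺ _ (lose y∈ (≤⇒≤ᵇ (≤-reflexive y≡i)))))

    within-≡ : ∀ i {x} → x ∈ vertices → within G C i x ≡ (dist x ≤ᵇ i)
    within-≡ zero    {x} x∈ = trans (dist-code x∈) (≡ᵇ0≡≤ᵇ0 (dist x))
    within-≡ (suc i) {x} x∈ = begin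
        within G C i x ∨ any (λ y → adj x y ∧ within G C i y) vertices
      ≡⟨ cong₂ _∨_ (within-≡ i x∈) (any-∧ (adj x) (within G C i) vertices) ⟩
        (dist x ≤ᵇ i) ∨ any (within G C i) (filterᵇ (adj x) vertices)
      ≡⟨ cong (λ ys → (dist x ≤ᵇ i) ∨ any (within G C i) ys) (neighbours-≡ x∈) ⟩
        (dist x ≤ᵇ i) ∨ any (within G C i) (neighbours x)
      ≡⟨ cong ((dist x ≤ᵇ i) ∨_)
              (any-cong (neighbours x) (within-≡ i ∘ neighbours⊆vertices x∈)) ⟩
        (dist x ≤ᵇ i) ∨ any (λ y → dist y ≤ᵇ i) (neighbours x)
      ≡⟨ dist-≤ᵇ-suc i x∈ ⟩
        dist x ≤ᵇ suc i
      ∎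

    layer-≡ : ∀ i {x} → x ∈ vertices → layer G C i x ≡ (dist x ≡ᵇ i)
    layer-≡ zero    x∈ = dist-code x∈
    layer-≡ (suc i) {x} x∈ =
      trans (cong₂ (λ a b → a ∧ not b) (within-≡ (suc i) x∈) (within-≡ i x∈))
            (≤ᵇ1+n∧≰ᵇn≡≡ᵇ1+n (dist x) i)

    nbrsIn-≡ : ∀ j {x} → x ∈ vertices → nbrsIn G C j x ≡ count j (map dist (neighbours x))
    nbrsIn-≡ j {x} x∈ = begin
        length (filterᵇ (λ y → adj x y ∧ layer G C j y) vertices)
      ≡⟨ cong length (filterᵇ-∧ (adj x) (layer G C j) vertices) ⟩
        length (filterᵇ (layer G C j) (filterᵇ (adj x) vertices))
      ≡⟨ cong (length ∘ filterᵇ (layer G C j)) (neighbours-≡ x∈) ⟩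
        length (filterᵇ (layer G C j) (neighbours x))
      ≡⟨ cong length (filterᵇ-cong (neighbours x) (layer-≡ j ∘ neighbours⊆vertices x∈)) ⟩
        length (filterᵇ (λ y → dist y ≡ᵇ j) (neighbours x))
      ≡⟨ sym (length-filterᵇ-map (_≡ᵇ j) dist (neighbours x)) ⟩
        count j (map dist (neighbours x))
      ∎

    covering-radius : ∀ ρ → (∀ {x} → x ∈ vertices → dist x ≤ ρ) →
                      ∀ {x} → x ∈ vertices → dist x ≡ ρ → CoveringRadius G C ρ
    covering-radius ρ bounded {x} x∈ dist≡ρ =
      (λ y y∈ → trans (within-≡ ρ y∈) (T⇒≡true (≤⇒≤ᵇ (bounded y∈)))) ,
      (x , x∈ , trans (layer-≡ ρ x∈) (T⇒≡true (≡⇒≡ᵇ (dist x) ρ dist≡ρ)))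

    completely-regular :
      (α β γ : ℕ → ℕ) →
      (∀ {x} → x ∈ vertices → count (dist x) (map dist (neighbours x)) ≡ α (dist x)) →
      (∀ {x} → x ∈ vertices → count (suc (dist x)) (map dist (neighbours x)) ≡ β (dist x)) →
      (∀ {x} j → x ∈ vertices → dist x ≡ suc j → count j (map dist (neighbours x)) ≡ γ (dist x)) →
      CompletelyRegular G C
    completely-regular α β γ α-count β-count γ-count = α , β , γ , regular
      where
      regular : ∀ i x → x ∈ vertices → layer G C i x ≡ true →
                nbrsIn G C i x ≡ α i × nbrsIn G C (suc i) x ≡ β i ×
                (∀ j → i ≡ suc j → nbrsIn G C j x ≡ γ i)
      regular i x x∈ x∈Cᵢ with ≡ᵇ⇒≡ (dist x) i (≡true⇒T (trans (sym (layer-≡ i x∈)) x∈Cᵢ))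
      ... | refl = trans (nbrsIn-≡ i x∈) (α-count x∈) ,
                   trans (nbrsIn-≡ (suc i) x∈) (β-count x∈) ,
                   λ j i≡1+j → trans (nbrsIn-≡ j x∈) (γ-count j x∈ i≡1+j)

∈-allSubsets : ∀ {n} (p : Subset n) → p ∈ allSubsets n
∈-allSubsets []                  = here refl
∈-allSubsets {suc n} (false ∷ p) = ∈-++⁺ˡ (∈-map⁺ (false ∷_) (∈-allSubsets p))
∈-allSubsets {suc n} (true ∷ p)  =
  ∈-++⁺ʳ (map (false ∷_) (allSubsets n)) (∈-map⁺ (true ∷_) (∈-allSubsets p))

∈-Johnson : ∀ {n k} {p : Subset n} → ∣ p ∣ ≡ k → p ∈ FinGraph.vertices (Johnson n k)
∈-Johnson {n} {k} {p} ∣p∣≡k =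
  ∈-filter⁺ (T? ∘ λ q → ∣ q ∣ ≡ᵇ k) (∈-allSubsets p) (≡⇒≡ᵇ ∣ p ∣ k ∣p∣≡k)

∈-Johnson⇒size : ∀ {n k} {p : Subset n} → p ∈ FinGraph.vertices (Johnson n k) → ∣ p ∣ ≡ k
∈-Johnson⇒size {n} {k} {p} p∈ =
  ≡ᵇ⇒≡ ∣ p ∣ k (proj₂ (∈-filter⁻ (T? ∘ λ q → ∣ q ∣ ≡ᵇ k) {xs = allSubsets n} p∈))

filterᵇ-allSubsets : ∀ {n} (P : Subset (suc n) → Bool) →
  filterᵇ P (allSubsets (suc n)) ≡
  map (false ∷_) (filterᵇ (P ∘ (false ∷_)) (allSubsets n)) ++
  map (true ∷_) (filterᵇ (P ∘ (true ∷_)) (allSubsets n))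
filterᵇ-allSubsets {n} P =
  trans (filter-++ (T? ∘ P) (map (false ∷_) (allSubsets n)) (map (true ∷_) (allSubsets n)))
        (cong₂ _++_ (filterᵇ-map P (false ∷_) (allSubsets n))
                    (filterᵇ-map P (true ∷_) (allSubsets n)))

∣p∣≡∣p∩q∣+∣p∩∁q∣ : ∀ {n} (p q : Subset n) → ∣ p ∣ ≡ ∣ p ∩ q ∣ + ∣ p ∩ ∁ q ∣
∣p∣≡∣p∩q∣+∣p∩∁q∣ []          []          = refl
∣p∣≡∣p∩q∣+∣p∩∁q∣ (true ∷ p)  (true ∷ q)  = cong suc (∣p∣≡∣p∩q∣+∣p∩∁q∣ p q)
∣p∣≡∣p∩q∣+∣p∩∁q∣ (true ∷ p)  (false ∷ q) =
  trans (cong suc (∣p∣≡∣p∩q∣+∣p∩∁q∣ p q)) (sym (+-suc _ _))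
∣p∣≡∣p∩q∣+∣p∩∁q∣ (false ∷ p) (_ ∷ q)     = ∣p∣≡∣p∩q∣+∣p∩∁q∣ p q

isExchange : ∀ {n} → Subset n → Subset n → ℕ → ℕ → Bool
isExchange p q d e = (∣ p ∩ ∁ q ∣ ≡ᵇ d) ∧ (∣ q ∩ ∁ p ∣ ≡ᵇ e)

exchanges : ∀ {n} → Subset n → ℕ → ℕ → List (Subset n)
exchanges []          zero    zero    = [ [] ]
exchanges []          _       _       = []
exchanges (true ∷ p)  zero    e       = map (true ∷_) (exchanges p zero e)
exchanges (true ∷ p)  (suc d) e       =
  map (false ∷_) (exchanges p d e) ++ map (true ∷_) (exchanges p (suc d) e)
exchanges (false ∷ p) d       zero    = map (false ∷_) (exchanges p d zero)
exchanges (false ∷ p) d       (suc e) =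
  map (false ∷_) (exchanges p d (suc e)) ++ map (true ∷_) (exchanges p d e)

exchanges-≡ : ∀ {n} (p : Subset n) d e →
              exchanges p d e ≡ filterᵇ (λ q → isExchange p q d e) (allSubsets n)
exchanges-≡ []          zero    zero    = refl
exchanges-≡ []          zero    (suc e) = refl
exchanges-≡ []          (suc d) e       = refl
exchanges-≡ {suc n} (b ∷ p) d e =
  sym (trans (filterᵇ-allSubsets (λ q → isExchange (b ∷ p) q d e)) (by-first-point b d e))
  where
  A = allSubsets n
  by-first-point : ∀ b d e →
    map (false ∷_) (filterᵇ (λ q → isExchange (b ∷ p) (false ∷ q) d e) A) ++
    map (true ∷_) (filterᵇ (λ q → isExchange (b ∷ p) (true ∷ q) d e) A) ≡ exchanges (b ∷ p) d e
  by-first-point true zero e =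
    cong₂ _++_ (cong (map (false ∷_)) (filterᵇ-none (λ _ → refl) A))
               (cong (map (true ∷_)) (sym (exchanges-≡ p zero e)))
  by-first-point true (suc d) e =
    cong₂ _++_ (cong (map (false ∷_)) (sym (exchanges-≡ p d e)))
               (cong (map (true ∷_)) (sym (exchanges-≡ p (suc d) e)))
  by-first-point false d zero =
    trans (cong₂ _++_ (cong (map (false ∷_)) (sym (exchanges-≡ p d zero)))
                      (cong (map (true ∷_)) (filterᵇ-none (λ _ → ∧-zeroʳ _) A)))
          (++-identityʳ _)
  by-first-point false d (suc e) =
    cong₂ _++_ (cong (map (false ∷_)) (sym (exchanges-≡ p d (suc e))))
               (cong (map (true ∷_)) (sym (exchanges-≡ p d e)))

-- a = ∣p ∩ q∣, b = ∣p ∖ q∣, c = ∣q ∖ p∣ for ∣p∣ = 1 + k.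
exchange-arithmetic : ∀ a b c k → a + b ≡ suc k →
                      ((a + c ≡ᵇ suc k) ∧ (a ≡ᵇ k)) ≡ ((b ≡ᵇ 1) ∧ (c ≡ᵇ 1))
exchange-arithmetic zero    b c zero    refl = ∧-identityʳ _
exchange-arithmetic zero    b c (suc k) refl = ∧-zeroʳ _
exchange-arithmetic (suc a) b c zero    eq
  rewrite m+n≡0⇒n≡0 a (suc-injective eq) = ∧-zeroʳ _
exchange-arithmetic (suc a) b c (suc k) eq = exchange-arithmetic a b c k (suc-injective eq)

Johnson-neighbours : ∀ {n k} {p : Subset n} → ∣ p ∣ ≡ k → 0 < k →
  filterᵇ (FinGraph.adj (Johnson n k) p) (FinGraph.vertices (Johnson n k)) ≡ exchanges p 1 1
Johnson-neighbours {n} {suc k} {p} ∣p∣≡1+k (s≤s z≤n) = begin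
    filterᵇ (FinGraph.adj J p) (filterᵇ (λ q → ∣ q ∣ ≡ᵇ suc k) (allSubsets n))
  ≡⟨ sym (filterᵇ-∧ (λ q → ∣ q ∣ ≡ᵇ suc k) (FinGraph.adj J p) (allSubsets n)) ⟩
    filterᵇ (λ q → (∣ q ∣ ≡ᵇ suc k) ∧ FinGraph.adj J p q) (allSubsets n)
  ≡⟨ filterᵇ-cong (allSubsets n) (λ {q} _ → adjacent≡isExchange q) ⟩
    filterᵇ (λ q → isExchange p q 1 1) (allSubsets n)
  ≡⟨ sym (exchanges-≡ p 1 1) ⟩
    exchanges p 1 1
  ∎
  where
  J = Johnson n (suc k)
  adjacent≡isExchange : ∀ q → ((∣ q ∣ ≡ᵇ suc k) ∧ FinGraph.adj J p q) ≡ isExchange p q 1 1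
  adjacent≡isExchange q = begin
      S ∧ ((∣ p ∣ ≡ᵇ suc k) ∧ S ∧ M)
    ≡⟨ cong (λ b → S ∧ (b ∧ S ∧ M)) (T⇒≡true (≡⇒≡ᵇ _ _ ∣p∣≡1+k)) ⟩
      S ∧ (S ∧ M)
    ≡⟨ sym (∧-assoc S S M) ⟩
      (S ∧ S) ∧ M
    ≡⟨ cong (_∧ M) (∧-idem S) ⟩
      S ∧ M
    ≡⟨ cong (λ m → (m ≡ᵇ suc k) ∧ M)
            (trans (∣p∣≡∣p∩q∣+∣p∩∁q∣ q p) (cong (λ r → ∣ r ∣ + ∣ q ∩ ∁ p ∣) (∩-comm q p))) ⟩
      ((∣ p ∩ q ∣ + ∣ q ∩ ∁ p ∣ ≡ᵇ suc k) ∧ M)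
    ≡⟨ exchange-arithmetic (∣ p ∩ q ∣) (∣ p ∩ ∁ q ∣) (∣ q ∩ ∁ p ∣) k
                           (trans (sym (∣p∣≡∣p∩q∣+∣p∩∁q∣ p q)) ∣p∣≡1+k) ⟩
      isExchange p q 1 1
    ∎
    where
    S = ∣ q ∣ ≡ᵇ suc k
    M = ∣ p ∩ q ∣ ≡ᵇ k

-- A memo table on Subset n.  Evaluating a check against one shared table computes each
-- vertex's distance once, instead of once for every neighbour.
data Table (A : Set) : ℕ → Set where
  leaf : A → Table A zero
  node : ∀ {n} → Table A n → Table A n → Table A (suc n)

tabulate : ∀ {A n} → (Subset n → A) → Table A n
tabulate {n = zero}  f = leaf (f [])
tabulate {n = suc n} f = node (tabulate (f ∘ (false ∷_))) (tabulate (f ∘ (true ∷_)))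

lookup : ∀ {A n} → Table A n → Subset n → A
lookup (leaf a)   []          = a
lookup (node l r) (false ∷ p) = lookup l p
lookup (node l r) (true ∷ p)  = lookup r p

lookup-tabulate : ∀ {A n} (f : Subset n → A) (p : Subset n) → lookup (tabulate f) p ≡ f p
lookup-tabulate f []          = refl
lookup-tabulate f (false ∷ p) = lookup-tabulate (f ∘ (false ∷_)) p
lookup-tabulate f (true ∷ p)  = lookup-tabulate (f ∘ (true ∷_)) p

candidateDistance : (Subset 16 → Bool) → Subset 16 → ℕ
candidateDistance inC p = if inC p then 0 else if any inC (exchanges p 1 1) then 1 else 2

candidateDistance-≤2 : ∀ inC p → candidateDistance inC p ≤ 2
candidateDistance-≤2 inC p with inC p
... | true  = z≤n
... | false with any inC (exchanges p 1 1)
...   | true  = s≤s z≤n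
...   | false = ≤-refl

inCode : Subset 16 → Bool
inCode = lookup (tabulate hammingWeight6Supports)

distance : Subset 16 → ℕ
distance = lookup (tabulate (candidateDistance inCode))

distance-≤2 : ∀ p → distance p ≤ 2
distance-≤2 p = subst (_≤ 2) (sym (lookup-tabulate (candidateDistance inCode) p))
                      (candidateDistance-≤2 inCode p)

α β γ : ℕ → ℕ
α 1 = 50
α 2 = 12
α _ = 0
β 0 = 60
β 1 = 6
β _ = 0
γ 1 = 4
γ 2 = 48
γ _ = 0

Below : ℕ → List ℕ → Set
Below zero    ds = ⊤
Below (suc i) ds = i ∈ ds × count i ds ≡ γ (suc i)

below? : ∀ d ds → Dec (Below d ds)
below? zero    ds = yes tt
below? (suc i) ds = (i ∈? ds) ×-dec (count i ds ≟ γ (suc i))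

-- c: membership in the code, d: candidate distance, ds: candidate distances of the neighbours.
record Profile (c : Bool) (d : ℕ) (ds : List ℕ) : Set where
  constructor mkProfile
  field
    code      : c ≡ (d ≡ᵇ 0)
    lipschitz : All (λ e → d ≤ suc e) ds
    α-count   : count d ds ≡ α d
    β-count   : count (suc d) ds ≡ β d
    below     : Below d ds

profile? : ∀ c d ds → Dec (Profile c d ds)
profile? c d ds =
  map′ (λ (a , b , e , f , g) → mkProfile a b e f g)
       (λ P → let open Profile P in code , lipschitz , α-count , β-count , below)
       ((c ≟ᵇ (d ≡ᵇ 0)) ×-dec all? (λ e → d ≤? suc e) ds
          ×-dec (count d ds ≟ α d) ×-dec (count (suc d) ds ≟ β d) ×-dec below? d ds)

neighbourDistances : Subset 16 → List ℕ
neighbourDistances p = map distance (exchanges p 1 1)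

HasProfile : Subset 16 → Set
HasProfile p = Profile (hammingWeight6Supports p) (distance p) (neighbourDistances p)

hasProfileWith? : (Subset 16 → ℕ) → Subset 16 → Bool
hasProfileWith? dist p =
  ⌊ profile? (hammingWeight6Supports p) (dist p) (map dist (exchanges p 1 1)) ⌋

-- distance is passed as an argument, so that its table is built only once.
all-profiles : all (hasProfileWith? distance) (FinGraph.vertices (Johnson 16 6)) ≡ true
all-profiles = refl

profile : ∀ {p} → p ∈ FinGraph.vertices (Johnson 16 6) → HasProfile p
profile p∈ = toWitness (≡true⇒T
  (all-∈ (hasProfileWith? distance) (FinGraph.vertices (Johnson 16 6)) all-profiles p∈))


below : ∀ {p} j → p ∈ FinGraph.vertices (Johnson 16 6) → distance p ≡ suc j →
        Below (suc j) (neighbourDistances p)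
below {p} j p∈ d≡1+j =
  subst (λ d → Below d (neighbourDistances p)) d≡1+j (Profile.below (profile p∈))

distance-descends : ∀ {p} j → p ∈ FinGraph.vertices (Johnson 16 6) → distance p ≡ suc j →
                    ∃[ q ] (q ∈ exchanges p 1 1 × distance q ≡ j)
distance-descends j p∈ d≡1+j =
  let q , q∈ , j≡ = ∈-map⁻ distance (proj₁ (below j p∈ d≡1+j)) in q , q∈ , sym j≡

distance-lipschitz : ∀ {p q} → p ∈ FinGraph.vertices (Johnson 16 6) → q ∈ exchanges p 1 1 →
                     distance p ≤ suc (distance q)
distance-lipschitz p∈ q∈ = All.lookup (map⁻ (Profile.lipschitz (profile p∈))) q∈

-- Implicit arguments are supplied here and below wherever unification would otherwise have to
-- normalise a closed term such as the vertex list of J(16, 6).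
open DistanceCertificate (Johnson 16 6) hammingWeight6Supports (λ p → exchanges p 1 1)
  (λ {p} p∈ → Johnson-neighbours {p = p} (∈-Johnson⇒size {16} {6} p∈) (s≤s z≤n))
  distance (λ p∈ → Profile.code (profile p∈)) distance-descends distance-lipschitz

deepHole : Subset 16
deepHole = true ∷ true ∷ true ∷ true ∷ true ∷ true ∷ false ∷ false ∷
           false ∷ false ∷ false ∷ false ∷ false ∷ false ∷ false ∷ false ∷ []

corollary3 : CoveringRadius (Johnson 16 6) hammingWeight6Supports 2
           × CompletelyRegular (Johnson 16 6) hammingWeight6Supports
corollary3 =
  covering-radius 2 (λ {p} _ → distance-≤2 p) {deepHole} (∈-Johnson refl) refl ,
  completely-regular α β γ
    (λ p∈ → Profile.α-count (profile p∈))
    (λ p∈ → Profile.β-count (profile p∈))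
    (λ j p∈ d≡1+j → trans (proj₂ (below j p∈ d≡1+j)) (cong γ (sym d≡1+j)))
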